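{- Let $\mathbf z$ be the infinite fixed point, starting with $a$, of the morphism $h$ with $h(a)=aab$, $h(b)=b$. Let $n\ge 1$. If a factor of $\mathbf z$ has length at least $2^{n+1}+n-2$, then it contains a $b$-run of length at least $n$.
   Context: A factor of an infinite word is a finite contiguous block of it. A $b$-run of a word $w$ is a maximal occurrence of a block of consecutive $b$'s in $w$ (i.e., not extendable within $w$ by a $b$ on either side). -}

module Defs where

open import Data.Nat using (ℕ; zero; suc; _+_; _∸_; _≤_; _<_)
open import Data.List using (List; []; _∷_; concatMap)
open import Data.Product using (_×_)
open import Data.Sum using (_⊎_)
open import Relation.Binary.PropositionalEquality using (_≡_; _≢_)

data Letter : Set where
  a b : Letter

h : Letter → List Letter
h a = a ∷ a ∷ b ∷ []
h b = b ∷ []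

hWord : List Letter → List Letter
hWord = concatMap h

hIter : ℕ → List Letter
hIter zero    = a ∷ []
hIter (suc k) = hWord (hIter k)

-- i-th letter of a finite word (0-indexed); default b outside the word
-- (never used below: |h^(i+1)(a)| = 2^(i+2) - 1 > i)
letterAt : List Letter → ℕ → Letter
letterAt []       _       = b
letterAt (x ∷ _)  zero    = x
letterAt (_ ∷ xs) (suc i) = letterAt xs i

-- The infinite fixed point z = lim h^k(a) of h starting with a,
-- as a function ℕ → Letter: z(i) is the i-th letter of h^(i+1)(a)
-- (each h^k(a) is a prefix of h^(k+1)(a)).
z : ℕ → Letter
z i = letterAt (hIter (suc i)) i

-- The factor of z of length L starting at position i is z(i) … z(i+L-1).
record IsBRun (i L p m : ℕ) : Set where
  field
    nonempty  : 1 ≤ m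
    start-in  : i ≤ p
    end-in    : p + m ≤ i + L
    all-b     : ∀ j → p ≤ j → j < p + m → z j ≡ b
    left-max  : p ≡ i ⊎ z (p ∸ 1) ≢ b
    right-max : p + m ≡ i + L ⊎ z (p + m) ≢ b

-- Since h^(k+1)(a) = h^k(a) h^k(a) b, the prefix of z of length |h^(k+1)(a)| consists of two copies
-- of h^k(a) followed by a b, and h^k(a) ends with a b^k. By induction on k, a factor of that prefix
-- either lies in one copy (and its runs translate), or overlaps the final block b^(k+1), the
-- block b^k closing the first copy, or the block b^n closing the prefix h^n(a) of the second copy.
-- A factor of length |h^n(a)| + n - 1 is too long to meet any of these blocks in fewer than n letters.
module Submission where

open import Defs
open import Data.Nat using (ℕ; zero; suc; _+_; _∸_; _^_; _⊔_; _⊓_; _≤_; _<_; _≤′_; ≤′-refl; ≤′-step; z≤n; s≤s; _≟_; _≤?_)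
open import Data.Nat.Properties
open import Data.Nat.Tactic.RingSolver using (solve-∀)
open import Data.Product using (Σ; _×_; _,_)
open import Data.Sum using (_⊎_; inj₁; inj₂)
open import Data.List using ([]; _∷_; _++_; length)
open import Data.List.Properties using (length-++; concatMap-++)
open import Function using (_∘_)
open import Relation.Nullary using (Dec; yes; no; contradiction)
open import Relation.Binary.PropositionalEquality

a≢b : a ≢ b
a≢b ()

hIter-suc : ∀ k → hIter (suc k) ≡ hIter k ++ hIter k ++ b ∷ []
hIter-suc zero    = refl
hIter-suc (suc k) = begin
  hWord (hIter (suc k))                      ≡⟨ cong hWord (hIter-suc k) ⟩
  hWord (hIter k ++ hIter k ++ b ∷ [])       ≡⟨ concatMap-++ h (hIter k) _ ⟩
  hIter (suc k) ++ hWord (hIter k ++ b ∷ []) ≡⟨ cong (hIter (suc k) ++_) (concatMap-++ h (hIter k) (b ∷ [])) ⟩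
  hIter (suc k) ++ hIter (suc k) ++ b ∷ []   ∎
  where open ≡-Reasoning

ℓ : ℕ → ℕ
ℓ zero    = 1
ℓ (suc k) = ℓ k + suc (ℓ k)

length-hIter : ∀ k → length (hIter k) ≡ ℓ k
length-hIter zero    = refl
length-hIter (suc k) = begin
  length (hIter (suc k))                        ≡⟨ cong length (hIter-suc k) ⟩
  length (hIter k ++ hIter k ++ b ∷ [])         ≡⟨ length-++ (hIter k) ⟩
  length (hIter k) + length (hIter k ++ b ∷ []) ≡⟨ cong (length (hIter k) +_) (length-++ (hIter k)) ⟩
  length (hIter k) + (length (hIter k) + 1)     ≡⟨ cong₂ (λ u v → u + (v + 1)) (length-hIter k) (length-hIter k) ⟩
  ℓ k + (ℓ k + 1)                               ≡⟨ cong (ℓ k +_) (+-comm (ℓ k) 1) ⟩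
  ℓ k + suc (ℓ k)                               ∎
  where open ≡-Reasoning

suc-ℓ≡2^ : ∀ k → suc (ℓ k) ≡ 2 ^ suc k
suc-ℓ≡2^ zero    = refl
suc-ℓ≡2^ (suc k) = trans (cong (λ x → suc (ℓ k + x)) (sym (+-identityʳ (suc (ℓ k)))))
                           (cong (λ x → x + (x + 0)) (suc-ℓ≡2^ k))

ℓ<ℓ-suc : ∀ k → ℓ k < ℓ (suc k)
ℓ<ℓ-suc k = m<m+n (ℓ k) (s≤s z≤n)

ℓ-mono-≤ : ∀ {m n} → m ≤ n → ℓ m ≤ ℓ n
ℓ-mono-≤ = go ∘ ≤⇒≤′
  where
  go : ∀ {m n} → m ≤′ n → ℓ m ≤ ℓ n
  go ≤′-refl                    = ≤-refl
  go {n = suc n} (≤′-step m≤n) = ≤-trans (go m≤n) (<⇒≤ (ℓ<ℓ-suc n))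

ℓ-mono-< : ∀ {m n} → m < n → ℓ m < ℓ n
ℓ-mono-< {m} m<n = <-≤-trans (ℓ<ℓ-suc m) (ℓ-mono-≤ m<n)

n<ℓn : ∀ n → n < ℓ n
n<ℓn zero    = s≤s z≤n
n<ℓn (suc n) = ≤-trans (s≤s (n<ℓn n)) (ℓ<ℓ-suc n)

letterAt-++ˡ : ∀ xs ys {n i} → length xs ≡ n → i < n → letterAt (xs ++ ys) i ≡ letterAt xs i
letterAt-++ˡ (x ∷ xs) ys {i = zero}  refl _         = refl
letterAt-++ˡ (x ∷ xs) ys {i = suc i} refl (s≤s i<n) = letterAt-++ˡ xs ys refl i<n

letterAt-++ʳ : ∀ xs ys {n} j → length xs ≡ n → letterAt (xs ++ ys) (n + j) ≡ letterAt ys j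
letterAt-++ʳ []       ys j refl = refl
letterAt-++ʳ (x ∷ xs) ys j refl = letterAt-++ʳ xs ys j refl

letterAt-hIter : ∀ {m n i} → m ≤ n → i < ℓ m → letterAt (hIter n) i ≡ letterAt (hIter m) i
letterAt-hIter {m} {n} {i} m≤n i<ℓm = go (≤⇒≤′ m≤n)
  where
  go : ∀ {n} → m ≤′ n → letterAt (hIter n) i ≡ letterAt (hIter m) i
  go ≤′-refl               = refl
  go {suc n} (≤′-step m≤n) = begin
    letterAt (hIter (suc n)) i                ≡⟨ cong (λ w → letterAt w i) (hIter-suc n) ⟩
    letterAt (hIter n ++ hIter n ++ b ∷ []) i ≡⟨ letterAt-++ˡ (hIter n) _ (length-hIter n)
                                                   (<-≤-trans i<ℓm (ℓ-mono-≤ (≤′⇒≤ m≤n))) ⟩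
    letterAt (hIter n) i                      ≡⟨ go m≤n ⟩
    letterAt (hIter m) i                      ∎
    where open ≡-Reasoning

z-letterAt : ∀ k {i} → i < ℓ k → z i ≡ letterAt (hIter k) i
z-letterAt k {i} i<ℓk with ≤-total k (suc i)
... | inj₁ k≤1+i = letterAt-hIter k≤1+i i<ℓk
... | inj₂ 1+i≤k = sym (letterAt-hIter 1+i≤k (<-trans (n<1+n i) (n<ℓn (suc i))))

z-second-copy : ∀ k {j} → j ≤ ℓ k → z (ℓ k + j) ≡ letterAt (hIter k ++ b ∷ []) j
z-second-copy k {j} j≤ℓk = begin
  z (ℓ k + j)                                       ≡⟨ z-letterAt (suc k) (+-monoʳ-< (ℓ k) (s≤s j≤ℓk)) ⟩
  letterAt (hIter (suc k)) (ℓ k + j)                ≡⟨ cong (λ w → letterAt w (ℓ k + j)) (hIter-suc k) ⟩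
  letterAt (hIter k ++ hIter k ++ b ∷ []) (ℓ k + j) ≡⟨ letterAt-++ʳ (hIter k) _ j (length-hIter k) ⟩
  letterAt (hIter k ++ b ∷ []) j                    ∎
  where open ≡-Reasoning

z-periodic : ∀ k {j} → j < ℓ k → z (ℓ k + j) ≡ z j
z-periodic k {j} j<ℓk = begin
  z (ℓ k + j)                    ≡⟨ z-second-copy k (<⇒≤ j<ℓk) ⟩
  letterAt (hIter k ++ b ∷ []) j ≡⟨ letterAt-++ˡ (hIter k) _ (length-hIter k) j<ℓk ⟩
  letterAt (hIter k) j           ≡⟨ z-letterAt k j<ℓk ⟨
  z j                            ∎
  where open ≡-Reasoning

z-ℓ : ∀ k → z (ℓ k) ≡ a
z-ℓ k = trans (cong z (sym (+-identityʳ (ℓ k)))) (z-periodic k (<-≤-trans (s≤s z≤n) (n<ℓn k)))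

z-ℓ+ℓ : ∀ k → z (ℓ k + ℓ k) ≡ b
z-ℓ+ℓ k = begin
  z (ℓ k + ℓ k)                            ≡⟨ z-second-copy k ≤-refl ⟩
  letterAt (hIter k ++ b ∷ []) (ℓ k)       ≡⟨ cong (letterAt (hIter k ++ b ∷ [])) (+-identityʳ (ℓ k)) ⟨
  letterAt (hIter k ++ b ∷ []) (ℓ k + 0)   ≡⟨ letterAt-++ʳ (hIter k) (b ∷ []) 0 (length-hIter k) ⟩
  b                                        ∎
  where open ≡-Reasoning

-- The position of the last a in h^k(a).
lastA : ℕ → ℕ
lastA zero    = 0
lastA (suc k) = ℓ k + lastA k

ℓ≡lastA+k+1 : ∀ k → ℓ k ≡ suc (lastA k + k)
ℓ≡lastA+k+1 zero    = refl
ℓ≡lastA+k+1 (suc k) = begin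
  ℓ k + suc (ℓ k)               ≡⟨ cong (λ x → ℓ k + suc x) (ℓ≡lastA+k+1 k) ⟩
  ℓ k + suc (suc (lastA k + k)) ≡⟨ shuffle (ℓ k) (lastA k) k ⟩
  suc (ℓ k + lastA k + suc k)   ∎
  where
  open ≡-Reasoning
  shuffle : ∀ x y t → x + suc (suc (y + t)) ≡ suc (x + y + suc t)
  shuffle = solve-∀

z-lastA : ∀ k → z (lastA k) ≡ a
z-lastA zero    = refl
z-lastA (suc k) = trans (z-periodic k (subst (lastA k <_) (sym (ℓ≡lastA+k+1 k)) (s≤s (m≤m+n (lastA k) k))))
                        (z-lastA k)

z-after-lastA : ∀ k {t} → t < k → z (suc (lastA k + t)) ≡ b
z-after-lastA (suc k) {t} (s≤s t≤k) =
  trans (cong z (reassoc (ℓ k) (lastA k) t)) (in-second-copy (m≤n⇒m<n∨m≡n t≤k))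
  where
  reassoc : ∀ x y t → suc (x + y + t) ≡ x + suc (y + t)
  reassoc = solve-∀
  in-second-copy : t < k ⊎ t ≡ k → z (ℓ k + suc (lastA k + t)) ≡ b
  in-second-copy (inj₁ t<k) = trans (z-periodic k in-first-copy) (z-after-lastA k t<k)
    where
    in-first-copy : suc (lastA k + t) < ℓ k
    in-first-copy = subst (suc (lastA k + t) <_) (sym (ℓ≡lastA+k+1 k)) (s≤s (+-monoʳ-< (lastA k) t<k))
  in-second-copy (inj₂ t≡k) = trans (cong (λ x → z (ℓ k + x)) (trans (cong (λ x → suc (lastA k + x)) t≡k)
                                                                  (sym (ℓ≡lastA+k+1 k))))
                                  (z-ℓ+ℓ k)

record BBlockAfter (q m : ℕ) : Set where
  field
    before : z q ≢ b
    inside : ∀ {t} → t < m → z (suc q + t) ≡ b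
    after  : z (suc q + m) ≢ b

tail-bblock : ∀ k → BBlockAfter (lastA k) k
tail-bblock k = record
  { before = λ eq → a≢b (trans (sym (z-lastA k)) eq)
  ; inside = z-after-lastA k
  ; after  = λ eq → a≢b (trans (sym (z-ℓ k)) (trans (cong z (ℓ≡lastA+k+1 k)) eq))
  }

bblock-periodic : ∀ k {q m} → suc q + m < ℓ k → BBlockAfter q m → BBlockAfter (ℓ k + q) m
bblock-periodic k {q} {m} end<ℓk block = record
  { before = λ eq → before (trans (sym (z-periodic k (≤-trans (m≤m+n (suc q) m) (<⇒≤ end<ℓk)))) eq)
  ; inside = λ t<m → trans (shifted (<-trans (+-monoʳ-< (suc q) t<m) end<ℓk)) (inside t<m)
  ; after  = λ eq → after (trans (sym (shifted end<ℓk)) eq)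
  }
  where
  open BBlockAfter block
  shifted : ∀ {t} → suc q + t < ℓ k → z (suc (ℓ k + q) + t) ≡ z (suc q + t)
  shifted {t} lt = trans (cong z (reassoc (ℓ k) q t)) (z-periodic k lt)
    where
    reassoc : ∀ x y t → suc (x + y) + t ≡ x + (suc y + t)
    reassoc = solve-∀

-- For n = k the b^k closing the second copy runs into the final b, giving b^(k+1).
bblock-in-second-copy : ∀ {n k} → n ≤ k → Σ ℕ (λ m → n ≤ m × BBlockAfter (ℓ k + lastA n) m)
bblock-in-second-copy {n} {k} n≤k with m≤n⇒m<n∨m≡n n≤k
... | inj₁ n<k  = n , ≤-refl , bblock-periodic k end<ℓk (tail-bblock n)
  where
  end<ℓk : suc (lastA n) + n < ℓ k
  end<ℓk = subst (_< ℓ k) (ℓ≡lastA+k+1 n) (ℓ-mono-< n<k)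
... | inj₂ refl = suc n , n≤1+n n , tail-bblock (suc n)

HasLongBRun : ℕ → ℕ → ℕ → Set
HasLongBRun n i L = Σ ℕ (λ p → Σ ℕ (λ m → n ≤ m × IsBRun i L p m))

-- The run is the overlap of the factor with the block.
run-from-bblock : ∀ {n i L q m} → 1 ≤ n → BBlockAfter q m →
                  n ≤ L → i + n ≤ suc q + m → suc q + n ≤ i + L → n ≤ m → HasLongBRun n i L
run-from-bblock {n} {i} {L} {q} {m} 1≤n block n≤L i+n≤end start+n≤i+L n≤m = s , e ∸ s , n≤e∸s , record
  { nonempty  = ≤-trans 1≤n n≤e∸s
  ; start-in  = m≤m⊔n i (suc q)
  ; end-in    = subst (_≤ i + L) (sym s+[e∸s]≡e) (m⊓n≤m (i + L) (suc q + m))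
  ; all-b     = all-b
  ; left-max  = left-maximal (⊔-sel i (suc q))
  ; right-max = right-maximal (⊓-sel (i + L) (suc q + m))
  }
  where
  open BBlockAfter block
  s = i ⊔ suc q
  e = (i + L) ⊓ (suc q + m)
  s+n≤e : s + n ≤ e
  s+n≤e = subst (_≤ e) (sym (+-distribʳ-⊔ n i (suc q)))
                (⊔-lub (⊓-glb (+-monoʳ-≤ i n≤L) i+n≤end) (⊓-glb start+n≤i+L (+-monoʳ-≤ (suc q) n≤m)))
  s+[e∸s]≡e : s + (e ∸ s) ≡ e
  s+[e∸s]≡e = m+[n∸m]≡n (≤-trans (m≤m+n s n) s+n≤e)
  n≤e∸s : n ≤ e ∸ s
  n≤e∸s = +-cancelˡ-≤ s n (e ∸ s) (subst (s + n ≤_) (sym s+[e∸s]≡e) s+n≤e)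
  all-b : ∀ j → s ≤ j → j < s + (e ∸ s) → z j ≡ b
  all-b j s≤j j<end with m≤n⇒∃[o]m+o≡n (≤-trans (m≤n⊔m i (suc q)) s≤j)
  ... | t , refl = inside (+-cancelˡ-< (suc q) t m (<-≤-trans (subst (j <_) s+[e∸s]≡e j<end)
                                                               (m⊓n≤n (i + L) (suc q + m))))
  left-maximal : s ≡ i ⊎ s ≡ suc q → s ≡ i ⊎ z (s ∸ 1) ≢ b
  left-maximal (inj₁ s≡i)   = inj₁ s≡i
  left-maximal (inj₂ s≡q+1) = inj₂ (subst (λ x → z (x ∸ 1) ≢ b) (sym s≡q+1) before)
  right-maximal : e ≡ i + L ⊎ e ≡ suc q + m → s + (e ∸ s) ≡ i + L ⊎ z (s + (e ∸ s)) ≢ b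
  right-maximal (inj₁ e≡i+L) = inj₁ (trans s+[e∸s]≡e e≡i+L)
  right-maximal (inj₂ e≡end) = inj₂ (subst (λ x → z x ≢ b) (sym (trans s+[e∸s]≡e e≡end)) after)

IsBRun-periodic : ∀ k {i L p m} → i + L ≤ ℓ k → IsBRun i L p m → IsBRun (ℓ k + i) L (ℓ k + p) m
IsBRun-periodic k {i} {L} {p} {m} i+L≤ℓk run = record
  { nonempty  = nonempty
  ; start-in  = +-monoʳ-≤ (ℓ k) start-in
  ; end-in    = subst₂ _≤_ (sym (+-assoc (ℓ k) p m)) (sym (+-assoc (ℓ k) i L)) (+-monoʳ-≤ (ℓ k) end-in)
  ; all-b     = shifted-all-b
  ; left-max  = shifted-left-max start-in (≤-trans (m≤m+n p m) p+m≤ℓk) left-max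
  ; right-max = shifted-right-max right-max
  }
  where
  open IsBRun run
  p+m≤ℓk : p + m ≤ ℓ k
  p+m≤ℓk = ≤-trans end-in i+L≤ℓk
  shifted-end : p + m ≡ i + L → ℓ k + p + m ≡ ℓ k + i + L
  shifted-end eq = trans (+-assoc (ℓ k) p m) (trans (cong (ℓ k +_) eq) (sym (+-assoc (ℓ k) i L)))
  shifted-all-b : ∀ j → ℓ k + p ≤ j → j < ℓ k + p + m → z j ≡ b
  shifted-all-b j ℓk+p≤j j<end with m≤n⇒∃[o]m+o≡n (≤-trans (m≤m+n (ℓ k) p) ℓk+p≤j)
  ... | t , refl = trans (z-periodic k (<-≤-trans t<p+m p+m≤ℓk)) (all-b t (+-cancelˡ-≤ (ℓ k) p t ℓk+p≤j) t<p+m)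
    where
    t<p+m : t < p + m
    t<p+m = +-cancelˡ-< (ℓ k) t (p + m) (subst (ℓ k + t <_) (+-assoc (ℓ k) p m) j<end)
  shifted-left-max : ∀ {p} → i ≤ p → p ≤ ℓ k → p ≡ i ⊎ z (p ∸ 1) ≢ b → ℓ k + p ≡ ℓ k + i ⊎ z (ℓ k + p ∸ 1) ≢ b
  shifted-left-max _              _     (inj₁ p≡i) = inj₁ (cong (ℓ k +_) p≡i)
  shifted-left-max {zero}  i≤0    _     (inj₂ _)   = inj₁ (cong (ℓ k +_) (sym (n≤0⇒n≡0 i≤0)))
  shifted-left-max {suc p} _      p<ℓk  (inj₂ ne)  =
    inj₂ (λ eq → ne (trans (sym (z-periodic k p<ℓk)) (trans (cong (λ x → z (x ∸ 1)) (sym (+-suc (ℓ k) p))) eq)))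
  shifted-right-max : p + m ≡ i + L ⊎ z (p + m) ≢ b → ℓ k + p + m ≡ ℓ k + i + L ⊎ z (ℓ k + p + m) ≢ b
  shifted-right-max (inj₁ eq) = inj₁ (shifted-end eq)
  shifted-right-max (inj₂ ne) with p + m ≟ i + L
  ... | yes eq  = inj₁ (shifted-end eq)
  ... | no  neq = inj₂ (λ eq → ne (trans (sym (z-periodic k (<-≤-trans (≤∧≢⇒< end-in neq) i+L≤ℓk)))
                                        (trans (cong z (sym (+-assoc (ℓ k) p m))) eq)))

HasLongBRun-periodic : ∀ k {n i L} → i + L ≤ ℓ k → HasLongBRun n i L → HasLongBRun n (ℓ k + i) L
HasLongBRun-periodic k i+L≤ℓk (p , m , n≤m , run) = ℓ k + p , m , n≤m , IsBRun-periodic k i+L≤ℓk run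

long⇒n≤L : ∀ {n L} → ℓ n + n ≤ suc L → n ≤ L
long⇒n≤L {n} long = ≤-pred (≤-trans (+-monoˡ-≤ n (≤-trans (s≤s z≤n) (n<ℓn n))) long)

long⇒n≤k : ∀ {n L k} → ℓ n + n ≤ suc L → L ≤ ℓ k + ℓ k → n ≤ k
long⇒n≤k {n} {L} {k} long L≤ℓk+ℓk with n ≤? k
... | yes n≤k = n≤k
... | no  n≰k = contradiction (begin-strict
      ℓ n               <⟨ m<m+n (ℓ n) (≤-trans (s≤s z≤n) (≰⇒> n≰k)) ⟩
      ℓ n + n           ≤⟨ long ⟩
      suc L             ≤⟨ s≤s L≤ℓk+ℓk ⟩
      suc (ℓ k + ℓ k)   ≡⟨ +-suc (ℓ k) (ℓ k) ⟨
      ℓ (suc k)         ≤⟨ ℓ-mono-≤ (≰⇒> n≰k) ⟩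
      ℓ n               ∎) (<-irrefl refl)
  where open ≤-Reasoning

run-at-tail : ∀ K {n i L} → 1 ≤ n → n ≤ K → n ≤ L → i + n ≤ ℓ K → ℓ K ≤ i + L → HasLongBRun n i L
run-at-tail K {n} 1≤n n≤K n≤L i+n≤ℓK ℓK≤i+L =
  run-from-bblock 1≤n (tail-bblock K) n≤L (subst (_ ≤_) end≡ℓK i+n≤ℓK)
                  (≤-trans (+-monoʳ-≤ (suc (lastA K)) n≤K) (subst (_≤ _) end≡ℓK ℓK≤i+L)) n≤K
  where
  end≡ℓK : ℓ K ≡ suc (lastA K) + K
  end≡ℓK = ℓ≡lastA+k+1 K

run-meeting-second-copy : ∀ k {n i L} → 1 ≤ n → ℓ n + n ≤ suc L → n ≤ k → i ≤ ℓ k → ℓ k < i + n →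
                          HasLongBRun n i L
run-meeting-second-copy k {n} {i} {L} 1≤n long n≤k i≤ℓk ℓk<i+n with bblock-in-second-copy n≤k
... | m , n≤m , block = run-from-bblock 1≤n block (long⇒n≤L long) i+n≤end start+n≤i+L n≤m
  where
  start = suc (ℓ k + lastA n)
  i+n≤end : i + n ≤ start + m
  i+n≤end = +-mono-≤ (≤-trans i≤ℓk (≤-trans (m≤m+n (ℓ k) (lastA n)) (n≤1+n _))) n≤m
  start+n≡ℓk+ℓn : start + n ≡ ℓ k + ℓ n
  start+n≡ℓk+ℓn = trans (reassoc (ℓ k) (lastA n) n) (cong (ℓ k +_) (sym (ℓ≡lastA+k+1 n)))
    where
    reassoc : ∀ x y t → suc (x + y) + t ≡ x + suc (y + t)
    reassoc = solve-∀
  start+n≤i+L : start + n ≤ i + L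
  start+n≤i+L = subst (_≤ i + L) (sym start+n≡ℓk+ℓn)
                  (+-cancelˡ-≤ (suc n) (ℓ k + ℓ n) (i + L)
                    (subst₂ _≤_ (rearrange (ℓ k) (ℓ n) n) (rearrange′ i n L) (+-mono-≤ ℓk<i+n long)))
    where
    rearrange : ∀ x y t → suc x + (y + t) ≡ suc t + (x + y)
    rearrange = solve-∀
    rearrange′ : ∀ x t l → x + t + suc l ≡ suc t + (x + l)
    rearrange′ = solve-∀

misses-final-b : ∀ k {j} → j ≤ ℓ (suc k) → j ≢ ℓ (suc k) → j ≤ ℓ k + ℓ k
misses-final-b k {j} j≤ j≢ = ≤-pred (subst (j <_) (+-suc (ℓ k) (ℓ k)) (≤∧≢⇒< j≤ j≢))

run-in-prefix : ∀ K {n i L} → 1 ≤ n → ℓ n + n ≤ suc L → i + L ≤ ℓ K → HasLongBRun n i L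
run-in-prefix zero {n} {i} {L} 1≤n long i+L≤1 =
  contradiction (≤-trans 1≤n (long⇒n≤k {k = 0} long (m≤n⇒m≤1+n (≤-trans (m≤n+m L i) i+L≤1)))) λ ()
run-in-prefix (suc k) {n} {i} {L} 1≤n long i+L≤ℓK = cases (i + L ≤? ℓ k) (i + L ≟ ℓ (suc k)) (ℓ k ≤? i)
  where
  n≤L : n ≤ L
  n≤L = long⇒n≤L long
  within : i + L ≢ ℓ (suc k) → i + L ≤ ℓ k + ℓ k
  within = misses-final-b k i+L≤ℓK
  n≤k : i + L ≢ ℓ (suc k) → n ≤ k
  n≤k notEnd = long⇒n≤k long (≤-trans (m≤n+m L i) (within notEnd))
  cases : Dec (i + L ≤ ℓ k) → Dec (i + L ≡ ℓ (suc k)) → Dec (ℓ k ≤ i) → HasLongBRun n i L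
  cases (yes inFirst) _ _ = run-in-prefix k 1≤n long inFirst
  cases (no _) (yes atEnd) _ =
    run-at-tail (suc k) 1≤n (long⇒n≤k long (≤-trans (m≤n+m L i) (≤-trans i+L≤ℓK (m≤m+n _ _)))) n≤L
                (≤-trans (+-monoʳ-≤ i n≤L) i+L≤ℓK) (≤-reflexive (sym atEnd))
  cases (no _) (no notEnd) (yes inSecond) with m≤n⇒∃[o]m+o≡n inSecond
  ... | i′ , ℓk+i′≡i = subst (λ x → HasLongBRun n x L) ℓk+i′≡i
                         (HasLongBRun-periodic k i′+L≤ℓk (run-in-prefix k 1≤n long i′+L≤ℓk))
    where
    i′+L≤ℓk : i′ + L ≤ ℓ k
    i′+L≤ℓk = +-cancelˡ-≤ (ℓ k) (i′ + L) (ℓ k)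
                (subst (_≤ ℓ k + ℓ k) (trans (cong (_+ L) (sym ℓk+i′≡i)) (+-assoc (ℓ k) i′ L)) (within notEnd))
  cases (no notFirst) (no notEnd) (no notSecond) with i + n ≤? ℓ k
  ... | yes i+n≤ℓk = run-at-tail k 1≤n (n≤k notEnd) n≤L i+n≤ℓk (<⇒≤ (≰⇒> notFirst))
  ... | no  i+n≰ℓk = run-meeting-second-copy k 1≤n long (n≤k notEnd) (<⇒≤ (≰⇒> notSecond)) (≰⇒> i+n≰ℓk)

long-from-bound : ∀ n {L} → 2 ^ (n + 1) + n ∸ 2 ≤ L → ℓ n + n ≤ suc L
long-from-bound n {L} bound = ≤-trans (m≤n+m∸n (ℓ n + n) 1) (s≤s (subst (_≤ L) bound≡ bound))
  where
  bound≡ : 2 ^ (n + 1) + n ∸ 2 ≡ ℓ n + n ∸ 1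
  bound≡ = cong (λ x → x + n ∸ 2) (trans (cong (2 ^_) (+-comm n 1)) (sym (suc-ℓ≡2^ n)))

lemma4 : (n : ℕ) → 1 ≤ n → (i L : ℕ) → 2 ^ (n + 1) + n ∸ 2 ≤ L →
         Σ ℕ (λ p → Σ ℕ (λ m → n ≤ m × IsBRun i L p m))
lemma4 n 1≤n i L bound = run-in-prefix (i + L) 1≤n (long-from-bound n bound) (<⇒≤ (n<ℓn (i + L)))
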